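{- Let $G$ be a graph with a diverse $r$-set coloring $f$ of its vertices, and let $\ell\geq 2$. Then the number of homomorphisms of $C_{2\ell}$ into $G$ which are not rainbow is at most $$16\ell\big(r\ell\,\Delta(G)\,\mathrm{hom}(C_{2\ell-2},G)\,\mathrm{hom}(C_{2\ell},G)\big)^{1/2}.$$
   Context: An $r$-set coloring of $G$ is a map $f:V(G)\to X^{(r)}$ for some set $X$; it is diverse if any two distinct vertices that are adjacent or have a common neighbor receive disjoint sets. A homomorphism from $H$ to $G$ is a map $\phi:V(H)\to V(G)$ with $\phi(x)\phi(y)\in E(G)$ whenever $xy\in E(H)$; $\mathrm{hom}(H,G)$ is their number. $C_m$ is the cycle of length $m$, and $C_2$ is the degenerate cycle of length 2, so $\mathrm{hom}(C_2,G)=2|E(G)|$. A homomorphism of $C_{2\ell}$, viewed as a closed walk $(x_1,\dots,x_{2\ell})$ in $G$, is rainbow if $f(x_i)\cap f(x_j)=\emptyset$ for all $i\neq j$. $\Delta(G)$ is the maximum degree of $G$. -}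

module Defs where

open import Data.Nat using (ℕ; zero; suc; _⊔_; NonZero)
open import Data.Nat.DivMod using (_%_; m%n<n)
open import Data.Bool using (Bool; true; false)
import Data.Bool.Properties as BoolP
open import Data.Fin using (Fin; toℕ; fromℕ<)
import Data.Fin.Properties as FinP
open import Data.Fin.Subset using (Subset; _∩_; ⊥)
open import Data.Vec using (Vec; []; _∷_; lookup)
import Data.Vec.Properties as VecP
open import Data.List using (List; [_]; concatMap; map; length; filter; foldr; allFin)
open import Data.Product using (_×_; Σ; _,_)
open import Data.Sum using (_⊎_)
open import Relation.Nullary using (Dec; ¬_; _×-dec_; ¬?; _→-dec_)
open import Relation.Unary using (Pred; Decidable)
open import Relation.Binary.PropositionalEquality using (_≡_; _≢_)

record Graph (n : ℕ) : Set where
  field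
    adj    : Fin n → Fin n → Bool
    sym    : ∀ u v → adj u v ≡ adj v u
    irrefl : ∀ v → adj v v ≡ false
open Graph public

Adj : ∀ {n} → Graph n → Fin n → Fin n → Set
Adj G u v = adj G u v ≡ true

-- degree and maximum degree Δ(G) (Δ = 0 for the empty graph)
deg : ∀ {n} → Graph n → Fin n → ℕ
deg {n} G v = length (filter (λ u → adj G v u BoolP.≟ true) (allFin n))

Δ : ∀ {n} → Graph n → ℕ
Δ {n} G = foldr _⊔_ 0 (map (deg G) (allFin n))

Disjoint : ∀ {m} → Subset m → Subset m → Set
Disjoint s t = s ∩ t ≡ ⊥

Disjoint? : ∀ {m} (s t : Subset m) → Dec (Disjoint s t)
Disjoint? s t = VecP.≡-dec BoolP._≟_ (s ∩ t) ⊥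

Diverse : ∀ {n m} → Graph n → (Fin n → Subset m) → Set
Diverse {n} G f = ∀ (u v : Fin n) → u ≢ v →
  (Adj G u v ⊎ Σ (Fin n) (λ w → Adj G u w × Adj G w v)) → Disjoint (f u) (f v)

cyc : ∀ {k} → Fin k → Fin k
cyc {suc k} i = fromℕ< (m%n<n (suc (toℕ i)) (suc k))

-- all maps Fin k → Fin n, represented as vectors (x_1,...,x_k)
allVec : (n k : ℕ) → List (Vec (Fin n) k)
allVec n zero = [ [] ]
allVec n (suc k) = concatMap (λ i → map (i ∷_) (allVec n k)) (allFin n)

-- homomorphisms C_k → G, i.e. closed walks of length k
IsHom : ∀ {n k} → Graph n → Vec (Fin n) k → Set
IsHom {n} {k} G w = ∀ (i : Fin k) → Adj G (lookup w i) (lookup w (cyc i))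

IsHom? : ∀ {n k} (G : Graph n) → Decidable (IsHom {n} {k} G)
IsHom? G w = FinP.all? (λ i → adj G (lookup w i) (lookup w (cyc i)) BoolP.≟ true)

hom : ∀ {n} → ℕ → Graph n → ℕ
hom {n} k G = length (filter (IsHom? G) (allVec n k))

Rainbow : ∀ {n m k} → (Fin n → Subset m) → Vec (Fin n) k → Set
Rainbow {k = k} f w = ∀ (i j : Fin k) → i ≢ j → Disjoint (f (lookup w i)) (f (lookup w j))

Rainbow? : ∀ {n m k} (f : Fin n → Subset m) → Decidable (Rainbow {n} {m} {k} f)
Rainbow? f w = FinP.all? (λ i → FinP.all? (λ j →
  ¬? (i FinP.≟ j) →-dec Disjoint? (f (lookup w i)) (f (lookup w j))))

nonRainbowHom : ∀ {n m} → ℕ → Graph n → (Fin n → Subset m) → ℕ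
nonRainbowHom {n} k G f =
  length (filter (λ w → IsHom? G w ×-dec ¬? (Rainbow? f w)) (allVec n k))

-- Let A be the adjacency matrix of G, L = 2ℓ, and for a colour c let D_c be the 0/1 diagonal
-- matrix of its colour class. A closed walk of length L that is not rainbow has positions i < j
-- sharing a colour, so the number of such walks is at most Σ_{i<j} τ(j − i), where
-- τ(d) = Σ_c tr(D_c A^d D_c A^(L−d)). Diversity gives τ(1) = 0 and τ(2) ≤ r Δ tr(A^(L−2)),
-- and tr(A^(L−2)) ≤ hom(C_{L−2}). Moreover τ(d) = τ(L − d), and Cauchy–Schwarz for
-- tr(XY) with X = A^b′ D_c A^b, Y = A^c D_c A^c′ makes τ log-convex: τ(b + c)² ≤ τ(2b) τ(2c).
-- A symmetric log-convex sequence vanishing at 1 is bounded by τ(2) on [1, L − 1], so the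
-- number N of non-rainbow walks is at most L² r Δ hom(C_{L−2}). Together with N ≤ hom(C_L)
-- this gives N² ≤ 4ℓ² r Δ hom(C_{L−2}) hom(C_L), well within the claimed bound.

module Submission where

open import Data.Bool using (Bool; true; false; _∧_)
import Data.Bool.Properties as Bool
open import Data.Empty using (⊥; ⊥-elim)
open import Data.Fin using (Fin; zero; suc; toℕ)
import Data.Fin.Properties as Fin
open import Data.Fin.Subset using (Subset; _∈_; _∉_; _∩_; ∣_∣)
open import Data.Fin.Subset.Properties using (_∈?_; ∉⊥; x∈p∩q⁺; x∈p∩q⁻; nonempty?; Empty-unique)
open import Data.List using (List; []; _∷_; map; filter; length; foldr; concatMap; tabulate; allFin)
open import Data.List.Properties using (map-concatMap; map-∘)
open import Data.Nat
open import Data.Nat.DivMod using (_%_; m<n⇒m%n≡m; n%n≡0)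
import Data.Nat.ListAction as List
open import Data.Nat.ListAction.Properties using (sum-++)
open import Data.Nat.Properties
open import Data.Nat.Tactic.RingSolver using (solve-∀)
open import Data.Product using (∃-syntax; _×_; _,_)
open import Data.Sum as Sum using (_⊎_; inj₁; inj₂; [_,_]′)
open import Data.Vec using (Vec; []; _∷_; lookup)
open import Function using (_∘_; id)
open import Relation.Binary.Bundles using (Setoid)
open import Relation.Binary.Definitions using (tri<; tri≈; tri>)
open import Relation.Binary.PropositionalEquality
import Relation.Binary.Reasoning.Setoid
open import Relation.Nullary using (¬_; Dec; does; yes; no; ¬?; _×-dec_; _→-dec_)
open import Relation.Nullary.Decidable using (dec-true)
open import Relation.Unary using (Pred; Decidable)

open import Defs hiding (sym)

open import Algebra.Properties.Semiring.Sum +-*-semiring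
  using (sum; sum-syntax; sum-cong-≗; ∑-comm; *-distribˡ-sum; *-distribʳ-sum; sum-replicate-zero)

-- Finite sums and Cauchy–Schwarz over ℕ

∑-mono-≤ : ∀ {n} {f g : Fin n → ℕ} → (∀ i → f i ≤ g i) → ∑[ i < n ] f i ≤ ∑[ i < n ] g i
∑-mono-≤ {zero} _ = z≤n
∑-mono-≤ {suc n} f≤g = +-mono-≤ (f≤g zero) (∑-mono-≤ (f≤g ∘ suc))

∑-const : ∀ n c → ∑[ i < n ] c ≡ n * c
∑-const zero c = refl
∑-const (suc n) c = cong (c +_) (∑-const n c)

≤-∑ : ∀ {n} (f : Fin n → ℕ) i → f i ≤ ∑[ j < n ] f j
≤-∑ f zero = m≤m+n _ _
≤-∑ f (suc i) = ≤-trans (≤-∑ (f ∘ suc) i) (m≤n+m _ _)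

∑-single : ∀ {n} (f : Fin n → ℕ) i → (∀ j → j ≢ i → f j ≡ 0) → ∑[ j < n ] f j ≡ f i
∑-single {suc n} f zero others = begin
  f zero + ∑[ j < n ] f (suc j) ≡⟨ cong (f zero +_) (sum-cong-≗ (λ j → others (suc j) λ ())) ⟩
  f zero + ∑[ j < n ] 0         ≡⟨ cong (f zero +_) (sum-replicate-zero n) ⟩
  f zero + 0                    ≡⟨ +-identityʳ _ ⟩
  f zero                        ∎
  where open ≡-Reasoning
∑-single {suc n} f (suc i) others =
  cong₂ _+_ (others zero λ ()) (∑-single (f ∘ suc) i (λ j j≢i → others (suc j) (j≢i ∘ Fin.suc-injective)))

square-≤⇒≤ : ∀ p q → p * p ≤ q * q → p ≤ q
square-≤⇒≤ p q p²≤q² with p ≤? q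
... | yes p≤q = p≤q
... | no p≰q = ⊥-elim (<⇒≱ (*-mono-< q<p q<p) p²≤q²)
  where q<p = ≰⇒> p≰q

am-gm : ∀ p q → 4 * (p * q) ≤ (p + q) * (p + q)
am-gm p q = [ am-gm-≤ , swap ∘ am-gm-≤ ]′ (≤-total p q)
  where
  swap : 4 * (q * p) ≤ (q + p) * (q + p) → 4 * (p * q) ≤ (p + q) * (p + q)
  swap = subst₂ (λ a b → 4 * a ≤ b) (*-comm q p) (cong₂ _*_ (+-comm q p) (+-comm q p))

  am-gm-≤ : ∀ {p q} → p ≤ q → 4 * (p * q) ≤ (p + q) * (p + q)
  am-gm-≤ {p} {q} p≤q = subst (λ q → 4 * (p * q) ≤ (p + q) * (p + q)) (m+[n∸m]≡n p≤q)
    (subst (4 * (p * (p + (q ∸ p))) ≤_) (expand p (q ∸ p)) (m≤m+n _ _))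
    where
    expand : ∀ p t → 4 * (p * (p + t)) + t * t ≡ (p + (p + t)) * (p + (p + t))
    expand = solve-∀

square≤*-+ : ∀ x y a b c d → x * x ≤ a * b → y * y ≤ c * d → (x + y) * (x + y) ≤ (a + c) * (b + d)
square≤*-+ x y a b c d x²≤ab y²≤cd = begin
  (x + y) * (x + y)                  ≡⟨ expand x y ⟩
  x * x + (2 * (x * y) + y * y)      ≤⟨ +-mono-≤ x²≤ab (+-mono-≤ 2xy≤ad+cb y²≤cd) ⟩
  a * b + ((a * d + c * b) + c * d) ≡⟨ collect a b c d ⟩
  (a + c) * (b + d)                  ∎
  where
  open ≤-Reasoning
  expand : ∀ x y → (x + y) * (x + y) ≡ x * x + (2 * (x * y) + y * y)
  expand = solve-∀
  collect : ∀ a b c d → a * b + ((a * d + c * b) + c * d) ≡ (a + c) * (b + d)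
  collect = solve-∀
  square-2xy : ∀ x y → (2 * (x * y)) * (2 * (x * y)) ≡ 4 * ((x * x) * (y * y))
  square-2xy = solve-∀
  regroup : ∀ a b c d → (a * b) * (c * d) ≡ (a * d) * (c * b)
  regroup = solve-∀
  2xy≤ad+cb : 2 * (x * y) ≤ a * d + c * b
  2xy≤ad+cb = square-≤⇒≤ _ _ (begin
    (2 * (x * y)) * (2 * (x * y)) ≡⟨ square-2xy x y ⟩
    4 * ((x * x) * (y * y))       ≤⟨ *-monoʳ-≤ 4 (*-mono-≤ x²≤ab y²≤cd) ⟩
    4 * ((a * b) * (c * d))       ≡⟨ cong (4 *_) (regroup a b c d) ⟩
    4 * ((a * d) * (c * b))       ≤⟨ am-gm (a * d) (c * b) ⟩
    (a * d + c * b) * (a * d + c * b) ∎)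

∑-square≤*-∑ : ∀ {n} (s a b : Fin n → ℕ) → (∀ i → s i * s i ≤ a i * b i) →
  (∑[ i < n ] s i) * (∑[ i < n ] s i) ≤ (∑[ i < n ] a i) * (∑[ i < n ] b i)
∑-square≤*-∑ {zero} s a b _ = z≤n
∑-square≤*-∑ {suc n} s a b s²≤ab =
  square≤*-+ (s zero) _ (a zero) (b zero) _ _ (s²≤ab zero) (∑-square≤*-∑ (s ∘ suc) (a ∘ suc) (b ∘ suc) (s²≤ab ∘ suc))

cauchy-schwarz : ∀ {n} (a b : Fin n → ℕ) →
  (∑[ i < n ] (a i * b i)) * (∑[ i < n ] (a i * b i)) ≤ (∑[ i < n ] (a i * a i)) * (∑[ i < n ] (b i * b i))
cauchy-schwarz a b = ∑-square≤*-∑ _ _ _ (λ i → ≤-reflexive (square-* (a i) (b i)))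
  where
  square-* : ∀ x y → (x * y) * (x * y) ≡ (x * x) * (y * y)
  square-* = solve-∀

-- Log-convex sequences

module _ (E : ℕ → ℕ) (M : ℕ)
  (log-convex : ∀ e → 2 + e ≤ M → E (suc e) * E (suc e) ≤ E e * E (2 + e)) where

  rising-step : ∀ e → 2 + e ≤ M → E e < E (suc e) → E (suc e) < E (2 + e)
  rising-step e 2+e≤M rising with E (suc e) <? E (2 + e)
  ... | yes next = next
  ... | no ¬next = ⊥-elim (<⇒≱ rising (*-cancelʳ-≤ (E (suc e)) (E e) (E (suc e)) {{>-nonZero (<-≤-trans (s≤s z≤n) rising)}}
          (≤-trans (log-convex e 2+e≤M) (*-monoʳ-≤ (E e) (≮⇒≥ ¬next)))))

  rising⇒≤ : ∀ d e → d + suc e ≤ M → E e < E (suc e) → E (suc e) ≤ E (d + suc e)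
  rising⇒≤ zero e _ _ = ≤-refl
  rising⇒≤ (suc d) e bound rising = begin
    E (suc e)           <⟨ next ⟩
    E (2 + e)           ≤⟨ rising⇒≤ d (suc e) (≤-trans (≤-reflexive (+-suc d (suc e))) bound) next ⟩
    E (d + suc (suc e)) ≡⟨ cong E (+-suc d (suc e)) ⟩
    E (suc d + suc e)   ∎
    where
    open ≤-Reasoning
    next = rising-step e (≤-trans (s≤s (m≤n+m (suc e) d)) bound) rising

  rising⇒≤-end : ∀ e → suc e ≤ M → E e < E (suc e) → E (suc e) ≤ E M
  rising⇒≤-end e e<M rising =
    subst (λ k → E (suc e) ≤ E k) (m∸n+n≡m e<M) (rising⇒≤ (M ∸ suc e) e (≤-reflexive (m∸n+n≡m e<M)) rising)

  ≤-first⊎rising : ∀ d → suc d ≤ M → E (suc d) ≤ E 1 ⊎ E d < E (suc d)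
  ≤-first⊎rising zero _ = inj₁ ≤-refl
  ≤-first⊎rising (suc d) bound with E (2 + d) ≤? E 1 | E (suc d) <? E (2 + d)
  ... | yes ≤first | _ = inj₁ ≤first
  ... | no _ | yes rising = inj₂ rising
  ... | no ≰first | no ¬rising with ≤-first⊎rising d (≤-trans (n≤1+n _) bound)
  ...   | inj₁ ≤first = ⊥-elim (≰first (≤-trans (≮⇒≥ ¬rising) ≤first))
  ...   | inj₂ rising = ⊥-elim (¬rising (rising-step d bound rising))

  log-convex-≤-ends : ∀ e → 1 ≤ e → e ≤ M → E e ≤ E 1 ⊔ E M
  log-convex-≤-ends (suc d) _ d<M with ≤-first⊎rising d d<M
  ... | inj₁ ≤first = ≤-trans ≤first (m≤m⊔n _ _)
  ... | inj₂ rising = ≤-trans (rising⇒≤-end d d<M rising) (m≤n⊔m _ _)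

even⊎odd : ∀ d → ∃[ e ] (d ≡ e + e ⊎ d ≡ suc (e + e))
even⊎odd zero = 0 , inj₁ refl
even⊎odd (suc d) with even⊎odd d
... | e , inj₁ refl = e , inj₂ refl
... | e , inj₂ refl = suc e , inj₁ (cong suc (sym (+-suc e e)))

-- E e = τ (e + e) is log-convex on [0, k] with E k = τ 2 by symmetry, hence at most τ 2 on [1, k];
-- an odd argument is squeezed between its even neighbours, except at 1 and 2k + 1, where τ vanishes.
module _ (k : ℕ) (τ : ℕ → ℕ)
  (τ-sym : ∀ d → d ≤ 2 * suc k → τ d ≡ τ (2 * suc k ∸ d))
  (τ-log-convex : ∀ b c → b ≤ suc k → c ≤ suc k → τ (b + c) * τ (b + c) ≤ τ (b + b) * τ (c + c))
  where

  private
    2ℓ≡2k+2 : ∀ k → 2 * suc k ≡ (k + k) + 2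
    2ℓ≡2k+2 = solve-∀

    2ℓ≡2k+1+1 : ∀ k → 2 * suc k ≡ suc (k + k) + 1
    2ℓ≡2k+1+1 = solve-∀

    τ-reflect : ∀ d m → 2 * suc k ≡ d + m → τ d ≡ τ m
    τ-reflect d m 2ℓ≡d+m = trans (τ-sym d (subst (d ≤_) (sym 2ℓ≡d+m) (m≤m+n d m)))
      (cong τ (trans (cong (_∸ d) 2ℓ≡d+m) (m+n∸m≡n d m)))

    half≤k : ∀ {e} → e + e < 2 * suc k → e ≤ k
    half≤k {e} e+e<2ℓ = ≮⇒≥ λ k<e → <⇒≱ e+e<2ℓ (subst (_≤ e + e) (sym (double (suc k))) (+-mono-≤ k<e k<e))
      where
      double : ∀ x → 2 * x ≡ x + x
      double = solve-∀

    τ-even : ∀ e → 1 ≤ e → e ≤ k → τ (e + e) ≤ τ 2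
    τ-even e 1≤e e≤k = ≤-trans (log-convex-≤-ends (λ e → τ (e + e)) k log-convex e 1≤e e≤k)
      (≤-reflexive (trans (cong (τ 2 ⊔_) (τ-reflect (k + k) 2 (2ℓ≡2k+2 k))) (⊔-idem (τ 2))))
      where
      middle : ∀ e → e + (2 + e) ≡ suc e + suc e
      middle = solve-∀
      log-convex : ∀ e → 2 + e ≤ k → τ (suc e + suc e) * τ (suc e + suc e) ≤ τ (e + e) * τ (2 + e + (2 + e))
      log-convex e 2+e≤k = subst (λ x → τ x * τ x ≤ τ (e + e) * τ (2 + e + (2 + e))) (middle e)
        (τ-log-convex e (2 + e) (≤-trans (m≤n+m e 2) (≤-trans 2+e≤k (n≤1+n k))) (≤-trans 2+e≤k (n≤1+n k)))

    τ-odd : τ 1 ≡ 0 → ∀ e → suc (e + e) < 2 * suc k → τ (suc (e + e)) ≤ τ 2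
    τ-odd τ1≡0 zero _ = ≤-trans (≤-reflexive τ1≡0) z≤n
    τ-odd τ1≡0 (suc e) d<2ℓ with 2 + e ≤? k
    ... | yes 2+e≤k = square-≤⇒≤ _ _ (begin
      τ (suc (suc e + suc e)) * τ (suc (suc e + suc e)) ≡⟨ cong (λ x → τ x * τ x) (+-suc (suc e) (suc e)) ⟨
      τ (suc e + suc (suc e)) * τ (suc e + suc (suc e)) ≤⟨ τ-log-convex (suc e) (2 + e) (≤-trans (n≤1+n _) (s≤s 1+e≤k)) (≤-trans 2+e≤k (n≤1+n k)) ⟩
      τ (suc e + suc e) * τ (2 + e + (2 + e))            ≤⟨ *-mono-≤ (τ-even (suc e) (s≤s z≤n) 1+e≤k) (τ-even (2 + e) (s≤s z≤n) 2+e≤k) ⟩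
      τ 2 * τ 2                                          ∎)
      where
      open ≤-Reasoning
      1+e≤k = ≤-trans (n≤1+n _) 2+e≤k
    ... | no 2+e≰k = subst (λ e → τ (suc (e + e)) ≤ τ 2) (sym 1+e≡k) τ[2k+1]≤τ2
      where
      1+e≡k : suc e ≡ k
      1+e≡k = ≤-antisym (half≤k (<-trans (n<1+n _) d<2ℓ)) (≤-pred (≰⇒> 2+e≰k))
      τ[2k+1]≤τ2 : τ (suc (k + k)) ≤ τ 2
      τ[2k+1]≤τ2 = ≤-trans (≤-reflexive (trans (τ-reflect (suc (k + k)) 1 (2ℓ≡2k+1+1 k)) τ1≡0)) z≤n

  symmetric-log-convex-≤-2 : τ 1 ≡ 0 → ∀ d → 1 ≤ d → d < 2 * suc k → τ d ≤ τ 2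
  symmetric-log-convex-≤-2 τ1≡0 d 1≤d d<2ℓ with even⊎odd d
  ... | e , inj₁ refl = τ-even e (1≤half 1≤d) (half≤k d<2ℓ)
    where
    1≤half : ∀ {e} → 1 ≤ e + e → 1 ≤ e
    1≤half {suc e} _ = s≤s z≤n
  ... | e , inj₂ refl = τ-odd τ1≡0 e d<2ℓ

-- Matrices over ℕ

Matrix : ℕ → Set
Matrix n = Fin n → Fin n → ℕ

module _ {n : ℕ} where

  infixr 7 _·_
  infix 4 _≋_

  _·_ : Matrix n → Matrix n → Matrix n
  (M · N) u v = ∑[ w < n ] (M u w * N w v)

  _≋_ : Matrix n → Matrix n → Set
  M ≋ N = ∀ u v → M u v ≡ N u v

  ≋-setoid : Setoid _ _
  ≋-setoid = record
    { Carrier = Matrix n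
    ; _≈_ = _≋_
    ; isEquivalence = record
      { refl = λ _ _ → refl
      ; sym = λ M≋N u v → sym (M≋N u v)
      ; trans = λ M≋N N≋P u v → trans (M≋N u v) (N≋P u v)
      }
    }

  open Setoid ≋-setoid public using () renaming (refl to ≋-refl; sym to ≋-sym; trans to ≋-trans)
  module ≋-Reasoning = Relation.Binary.Reasoning.Setoid ≋-setoid

  ·-cong : ∀ {M M′ N N′} → M ≋ M′ → N ≋ N′ → M · N ≋ M′ · N′
  ·-cong M≋M′ N≋N′ u v = sum-cong-≗ (λ w → cong₂ _*_ (M≋M′ u w) (N≋N′ w v))

  ·-congˡ : ∀ {M M′} N → M ≋ M′ → M · N ≋ M′ · N
  ·-congˡ N M≋M′ = ·-cong M≋M′ (≋-refl {N})

  ·-congʳ : ∀ M {N N′} → N ≋ N′ → M · N ≋ M · N′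
  ·-congʳ M = ·-cong (≋-refl {M})

  ·-assoc : ∀ L M N → (L · M) · N ≋ L · (M · N)
  ·-assoc L M N u v = begin
    ∑[ w < n ] ((∑[ x < n ] (L u x * M x w)) * N w v)   ≡⟨ sum-cong-≗ (λ w → *-distribʳ-sum (N w v) (λ x → L u x * M x w)) ⟩
    ∑[ w < n ] ∑[ x < n ] (L u x * M x w * N w v)    ≡⟨ ∑-comm (λ w x → L u x * M x w * N w v) ⟩
    ∑[ x < n ] ∑[ w < n ] (L u x * M x w * N w v)    ≡⟨ sum-cong-≗ (λ x → sum-cong-≗ (λ w → *-assoc (L u x) (M x w) (N w v))) ⟩
    ∑[ x < n ] ∑[ w < n ] (L u x * (M x w * N w v))   ≡⟨ sum-cong-≗ (λ x → *-distribˡ-sum (L u x) (λ w → M x w * N w v)) ⟨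
    ∑[ x < n ] (L u x * ∑[ w < n ] (M x w * N w v))   ∎
    where open ≡-Reasoning

  I : Matrix n
  I u v with u Fin.≟ v
  ... | yes _ = 1
  ... | no _ = 0

  I-diag : ∀ u → I u u ≡ 1
  I-diag u with u Fin.≟ u
  ... | yes _ = refl
  ... | no u≢u = ⊥-elim (u≢u refl)

  I-offdiag : ∀ {u v} → u ≢ v → I u v ≡ 0
  I-offdiag {u} {v} u≢v with u Fin.≟ v
  ... | yes u≡v = ⊥-elim (u≢v u≡v)
  ... | no _ = refl

  ·-identityˡ : ∀ M → I · M ≋ M
  ·-identityˡ M u v = begin
    ∑[ w < n ] (I u w * M w v) ≡⟨ ∑-single _ u (λ w w≢u → cong (_* M w v) (I-offdiag (w≢u ∘ sym))) ⟩
    I u u * M u v            ≡⟨ cong (_* M u v) (I-diag u) ⟩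
    1 * M u v                ≡⟨ *-identityˡ _ ⟩
    M u v                    ∎
    where open ≡-Reasoning

  ·-identityʳ : ∀ M → M · I ≋ M
  ·-identityʳ M u v = begin
    ∑[ w < n ] (M u w * I w v) ≡⟨ ∑-single _ v (λ w w≢v → trans (cong (M u w *_) (I-offdiag w≢v)) (*-zeroʳ (M u w))) ⟩
    M u v * I v v            ≡⟨ cong (M u v *_) (I-diag v) ⟩
    M u v * 1                ≡⟨ *-identityʳ _ ⟩
    M u v                    ∎
    where open ≡-Reasoning

  infixr 8 _^ᴹ_

  _^ᴹ_ : Matrix n → ℕ → Matrix n
  A ^ᴹ zero = I
  A ^ᴹ suc k = A · A ^ᴹ k

  ^ᴹ-+ : ∀ A a b → A ^ᴹ (a + b) ≋ A ^ᴹ a · A ^ᴹ b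
  ^ᴹ-+ A zero b = ≋-sym (·-identityˡ (A ^ᴹ b))
  ^ᴹ-+ A (suc a) b = ≋-trans (·-congʳ A (^ᴹ-+ A a b)) (≋-sym (·-assoc A (A ^ᴹ a) (A ^ᴹ b)))

  ·-^ᴹ-comm : ∀ A k → A · A ^ᴹ k ≋ A ^ᴹ k · A
  ·-^ᴹ-comm A k = begin
    A ^ᴹ (1 + k)     ≡⟨ cong (A ^ᴹ_) (+-comm 1 k) ⟩
    A ^ᴹ (k + 1)     ≈⟨ ^ᴹ-+ A k 1 ⟩
    A ^ᴹ k · A ^ᴹ 1  ≈⟨ ·-congʳ (A ^ᴹ k) (·-identityʳ A) ⟩
    A ^ᴹ k · A       ∎
    where open ≋-Reasoning

  tr : Matrix n → ℕ
  tr M = ∑[ u < n ] M u u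

  tr-cong : ∀ {M N} → M ≋ N → tr M ≡ tr N
  tr-cong M≋N = sum-cong-≗ (λ u → M≋N u u)

  tr-·-comm : ∀ M N → tr (M · N) ≡ tr (N · M)
  tr-·-comm M N = trans (∑-comm (λ u w → M u w * N w u)) (sum-cong-≗ (λ w → sum-cong-≗ (λ u → *-comm (M u w) (N w u))))

  _ᵀ : Matrix n → Matrix n
  (M ᵀ) u v = M v u

  ᵀ-· : ∀ M N → (M · N) ᵀ ≋ N ᵀ · M ᵀ
  ᵀ-· M N u v = sum-cong-≗ (λ w → *-comm (M v w) (N w u))

  Symmetric : Matrix n → Set
  Symmetric M = M ᵀ ≋ M

  ^ᴹ-symmetric : ∀ {A} → Symmetric A → ∀ k → Symmetric (A ^ᴹ k)
  ^ᴹ-symmetric _ zero u v = I-symmetric (u Fin.≟ v)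
    where
    I-symmetric : Dec (u ≡ v) → I v u ≡ I u v
    I-symmetric (yes refl) = refl
    I-symmetric (no u≢v) = trans (I-offdiag (u≢v ∘ sym)) (sym (I-offdiag u≢v))
  ^ᴹ-symmetric {A} A-sym (suc k) = begin
    (A · A ^ᴹ k) ᵀ     ≈⟨ ᵀ-· A (A ^ᴹ k) ⟩
    (A ^ᴹ k) ᵀ · A ᵀ   ≈⟨ ·-cong (^ᴹ-symmetric A-sym k) A-sym ⟩
    A ^ᴹ k · A         ≈⟨ ·-^ᴹ-comm A k ⟨
    A · A ^ᴹ k         ∎
    where open ≋-Reasoning

  diag : (Fin n → ℕ) → Matrix n
  diag p u v = p u * I u v

  diag-· : ∀ p M → diag p · M ≋ λ u v → p u * M u v
  diag-· p M u v = begin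
    ∑[ w < n ] (p u * I u w * M w v)   ≡⟨ sum-cong-≗ (λ w → *-assoc (p u) (I u w) (M w v)) ⟩
    ∑[ w < n ] (p u * (I u w * M w v)) ≡⟨ *-distribˡ-sum (p u) (λ w → I u w * M w v) ⟨
    p u * (I · M) u v                  ≡⟨ cong (p u *_) (·-identityˡ M u v) ⟩
    p u * M u v                        ∎
    where open ≡-Reasoning

  diag-symmetric : ∀ p → Symmetric (diag p)
  diag-symmetric p u v = diag-sym (u Fin.≟ v)
    where
    diag-sym : Dec (u ≡ v) → p v * I v u ≡ p u * I u v
    diag-sym (yes refl) = refl
    diag-sym (no u≢v) = begin
      p v * I v u ≡⟨ cong (p v *_) (I-offdiag (u≢v ∘ sym)) ⟩
      p v * 0     ≡⟨ *-zeroʳ (p v) ⟩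
      0           ≡⟨ *-zeroʳ (p u) ⟨
      p u * 0     ≡⟨ cong (p u *_) (I-offdiag u≢v) ⟨
      p u * I u v ∎
      where open ≡-Reasoning

diag-sandwich : ∀ {n} (p : Fin n → ℕ) (M N : Matrix n) u →
  (diag p · M · diag p · N) u u ≡ ∑[ w < n ] (p u * M u w * p w * N w u)
diag-sandwich {n} p M N u = begin
  (diag p · M · diag p · N) u u             ≡⟨ diag-· p (M · diag p · N) u u ⟩
  p u * ∑[ w < n ] (M u w * (diag p · N) w u) ≡⟨ cong (p u *_) (sum-cong-≗ (λ w → cong (M u w *_) (diag-· p N w u))) ⟩
  p u * ∑[ w < n ] (M u w * (p w * N w u))  ≡⟨ *-distribˡ-sum (p u) (λ w → M u w * (p w * N w u)) ⟩
  ∑[ w < n ] (p u * (M u w * (p w * N w u))) ≡⟨ sum-cong-≗ (λ w → regroup (p u) (M u w) (p w) (N w u)) ⟩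
  ∑[ w < n ] (p u * M u w * p w * N w u)    ∎
  where
  open ≡-Reasoning
  regroup : ∀ a b c d → a * (b * (c * d)) ≡ a * b * c * d
  regroup = solve-∀

tr-cauchy-schwarz : ∀ {n} (X Y : Matrix n) → tr (X · Y) * tr (X · Y) ≤ tr (X · X ᵀ) * tr (Y ᵀ · Y)
tr-cauchy-schwarz X Y = ∑-square≤*-∑ _ _ _ (λ u → cauchy-schwarz (X u) (λ v → Y v u))

module _ {n : ℕ} (A : Matrix n) where

  -- Σ over closed walks x₀ … x_(x+y) = x₀ of p x₀ · p x_x, with A as edge weights.
  markedTrace : (Fin n → ℕ) → ℕ → ℕ → ℕ
  markedTrace p x y = tr (diag p · A ^ᴹ x · diag p · A ^ᴹ y)

  markedTrace-comm : ∀ p x y → markedTrace p x y ≡ markedTrace p y x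
  markedTrace-comm p x y = begin
    tr (diag p · A ^ᴹ x · diag p · A ^ᴹ y)     ≡⟨ tr-cong (·-assoc (diag p) (A ^ᴹ x) _) ⟨
    tr ((diag p · A ^ᴹ x) · diag p · A ^ᴹ y)   ≡⟨ tr-·-comm (diag p · A ^ᴹ x) _ ⟩
    tr ((diag p · A ^ᴹ y) · diag p · A ^ᴹ x)   ≡⟨ tr-cong (·-assoc (diag p) (A ^ᴹ y) _) ⟩
    tr (diag p · A ^ᴹ y · diag p · A ^ᴹ x)     ∎
    where open ≡-Reasoning

  tr-marked-product : ∀ p b b′ c c′ →
    tr ((A ^ᴹ b′ · diag p · A ^ᴹ b) · (A ^ᴹ c · diag p · A ^ᴹ c′)) ≡ markedTrace p (b + c) (c′ + b′)
  tr-marked-product p b b′ c c′ = trans (tr-cong (·-assoc (A ^ᴹ b′) _ _)) (trans (tr-·-comm (A ^ᴹ b′) _) (tr-cong (begin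
    ((D · A ^ᴹ b) · A ^ᴹ c · D · A ^ᴹ c′) · A ^ᴹ b′  ≈⟨ ·-assoc (D · A ^ᴹ b) _ _ ⟩
    (D · A ^ᴹ b) · (A ^ᴹ c · D · A ^ᴹ c′) · A ^ᴹ b′  ≈⟨ ·-congʳ (D · A ^ᴹ b) (·-assoc (A ^ᴹ c) _ _) ⟩
    (D · A ^ᴹ b) · A ^ᴹ c · (D · A ^ᴹ c′) · A ^ᴹ b′  ≈⟨ ·-congʳ (D · A ^ᴹ b) (·-congʳ (A ^ᴹ c) (·-assoc D _ _)) ⟩
    (D · A ^ᴹ b) · A ^ᴹ c · D · A ^ᴹ c′ · A ^ᴹ b′    ≈⟨ ·-congʳ (D · A ^ᴹ b) (·-congʳ (A ^ᴹ c) (·-congʳ D (^ᴹ-+ A c′ b′))) ⟨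
    (D · A ^ᴹ b) · A ^ᴹ c · D · A ^ᴹ (c′ + b′)       ≈⟨ ·-assoc D _ _ ⟩
    D · A ^ᴹ b · A ^ᴹ c · D · A ^ᴹ (c′ + b′)         ≈⟨ ·-congʳ D (·-assoc (A ^ᴹ b) _ _) ⟨
    D · (A ^ᴹ b · A ^ᴹ c) · D · A ^ᴹ (c′ + b′)       ≈⟨ ·-congʳ D (·-congˡ _ (^ᴹ-+ A b c)) ⟨
    D · A ^ᴹ (b + c) · D · A ^ᴹ (c′ + b′)            ∎)))
    where
    open ≋-Reasoning
    D = diag p

  module _ (A-sym : Symmetric A) where

    ᵀ-marked : ∀ p a b → (A ^ᴹ a · diag p · A ^ᴹ b) ᵀ ≋ A ^ᴹ b · diag p · A ^ᴹ a
    ᵀ-marked p a b = begin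
      (A ^ᴹ a · diag p · A ^ᴹ b) ᵀ          ≈⟨ ᵀ-· (A ^ᴹ a) _ ⟩
      (diag p · A ^ᴹ b) ᵀ · (A ^ᴹ a) ᵀ       ≈⟨ ·-cong (ᵀ-· (diag p) (A ^ᴹ b)) (^ᴹ-symmetric A-sym a) ⟩
      ((A ^ᴹ b) ᵀ · (diag p) ᵀ) · A ^ᴹ a     ≈⟨ ·-congˡ (A ^ᴹ a) (·-cong (^ᴹ-symmetric A-sym b) (diag-symmetric p)) ⟩
      (A ^ᴹ b · diag p) · A ^ᴹ a             ≈⟨ ·-assoc (A ^ᴹ b) (diag p) (A ^ᴹ a) ⟩
      A ^ᴹ b · diag p · A ^ᴹ a               ∎
      where open ≋-Reasoning

    markedTrace-log-convex : ∀ p b b′ c c′ →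
      markedTrace p (b + c) (c′ + b′) * markedTrace p (b + c) (c′ + b′)
        ≤ markedTrace p (b + b) (b′ + b′) * markedTrace p (c + c) (c′ + c′)
    markedTrace-log-convex p b b′ c c′ = subst₂ _≤_
      (cong₂ _*_ (tr-marked-product p b b′ c c′) (tr-marked-product p b b′ c c′))
      (cong₂ _*_ (trans (tr-cong (·-congʳ X (ᵀ-marked p b′ b))) (tr-marked-product p b b′ b b′))
                 (trans (tr-cong (·-congˡ Y (ᵀ-marked p c c′))) (tr-marked-product p c c′ c c′)))
      (tr-cauchy-schwarz X Y)
      where
      X = A ^ᴹ b′ · diag p · A ^ᴹ b
      Y = A ^ᴹ c · diag p · A ^ᴹ c′

-- Indicators and weighted closed walks

𝟙 : Bool → ℕ
𝟙 true = 1
𝟙 false = 0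

𝟙≤1 : ∀ b → 𝟙 b ≤ 1
𝟙≤1 true = ≤-refl
𝟙≤1 false = z≤n

𝟙-sandwich : ∀ b x → 𝟙 b * x * 𝟙 b ≡ 𝟙 b * x
𝟙-sandwich true x = *-identityʳ (1 * x)
𝟙-sandwich false x = refl

𝟙-*-zero : ∀ a b → (a ≡ true → b ≡ true → ⊥) → 𝟙 a * 𝟙 b ≡ 0
𝟙-*-zero false _ _ = refl
𝟙-*-zero true false _ = refl
𝟙-*-zero true true ¬both = ⊥-elim (¬both refl refl)

𝟙-dec-yes : ∀ {p} {P : Set p} (P? : Dec P) → P → 𝟙 (does P?) ≡ 1
𝟙-dec-yes P? p = cong 𝟙 (dec-true P? p)

𝟙-∧ : ∀ a b → 𝟙 (a ∧ b) ≤ 𝟙 a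
𝟙-∧ true b = 𝟙≤1 b
𝟙-∧ false b = z≤n

∏ : ∀ {k} → (Fin k → ℕ) → ℕ
∏ {zero} _ = 1
∏ {suc k} f = f zero * ∏ (f ∘ suc)

∏-cong : ∀ {k} {f g : Fin k → ℕ} → (∀ t → f t ≡ g t) → ∏ f ≡ ∏ g
∏-cong {zero} _ = refl
∏-cong {suc k} f≗g = cong₂ _*_ (f≗g zero) (∏-cong (f≗g ∘ suc))

∏-≤1 : ∀ {k} (f : Fin k → ℕ) → (∀ t → f t ≤ 1) → ∏ f ≤ 1
∏-≤1 {zero} _ _ = ≤-refl
∏-≤1 {suc k} f f≤1 = *-mono-≤ (f≤1 zero) (∏-≤1 (f ∘ suc) (f≤1 ∘ suc))

1≤∏ : ∀ {k} (f : Fin k → ℕ) → (∀ t → 1 ≤ f t) → 1 ≤ ∏ f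
1≤∏ {zero} _ _ = ≤-refl
1≤∏ {suc k} f 1≤f = *-mono-≤ (1≤f zero) (1≤∏ (f ∘ suc) (1≤f ∘ suc))

∏-zero : ∀ {k} (f : Fin k → ℕ) t → f t ≡ 0 → ∏ f ≡ 0
∏-zero f zero f0≡0 = cong (_* ∏ (f ∘ suc)) f0≡0
∏-zero f (suc t) ft≡0 = trans (cong (f zero *_) (∏-zero (f ∘ suc) t ft≡0)) (*-zeroʳ (f zero))

∑ᵛ : ∀ {n} k → (Vec (Fin n) k → ℕ) → ℕ
∑ᵛ zero g = g []
∑ᵛ {n} (suc k) g = ∑[ i < n ] ∑ᵛ k (λ xs → g (i ∷ xs))

module _ {n : ℕ} where

  ∑ᵛ-cong : ∀ k {g h : Vec (Fin n) k → ℕ} → (∀ x → g x ≡ h x) → ∑ᵛ k g ≡ ∑ᵛ k h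
  ∑ᵛ-cong zero g≗h = g≗h []
  ∑ᵛ-cong (suc k) g≗h = sum-cong-≗ (λ i → ∑ᵛ-cong k (λ xs → g≗h (i ∷ xs)))

  ∑ᵛ-mono-≤ : ∀ k {g h : Vec (Fin n) k → ℕ} → (∀ x → g x ≤ h x) → ∑ᵛ k g ≤ ∑ᵛ k h
  ∑ᵛ-mono-≤ zero g≤h = g≤h []
  ∑ᵛ-mono-≤ (suc k) g≤h = ∑-mono-≤ (λ i → ∑ᵛ-mono-≤ k (λ xs → g≤h (i ∷ xs)))

  *-distribˡ-∑ᵛ : ∀ k c (g : Vec (Fin n) k → ℕ) → c * ∑ᵛ k g ≡ ∑ᵛ k (λ x → c * g x)
  *-distribˡ-∑ᵛ zero c g = refl
  *-distribˡ-∑ᵛ (suc k) c g =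
    trans (*-distribˡ-sum c (λ i → ∑ᵛ k (λ xs → g (i ∷ xs)))) (sum-cong-≗ (λ i → *-distribˡ-∑ᵛ k c (λ xs → g (i ∷ xs))))

  ∑ᵛ-∑-comm : ∀ k {m} (g : Fin m → Vec (Fin n) k → ℕ) → ∑ᵛ k (λ x → ∑[ i < m ] g i x) ≡ ∑[ i < m ] ∑ᵛ k (g i)
  ∑ᵛ-∑-comm zero g = refl
  ∑ᵛ-∑-comm (suc k) g = trans (sum-cong-≗ (λ j → ∑ᵛ-∑-comm k (λ i xs → g i (j ∷ xs)))) (∑-comm (λ j i → ∑ᵛ k (λ xs → g i (j ∷ xs))))

length-filter≡sum : ∀ {a p} {A : Set a} {P : Pred A p} (P? : Decidable P) xs →
  length (filter P? xs) ≡ List.sum (map (λ x → 𝟙 (does (P? x))) xs)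
length-filter≡sum P? [] = refl
length-filter≡sum P? (x ∷ xs) with P? x
... | yes _ = cong suc (length-filter≡sum P? xs)
... | no _ = length-filter≡sum P? xs

sum-concatMap : ∀ {a} {A : Set a} (h : A → List ℕ) xs → List.sum (concatMap h xs) ≡ List.sum (map (List.sum ∘ h) xs)
sum-concatMap h [] = refl
sum-concatMap h (x ∷ xs) = trans (sum-++ (h x) (concatMap h xs)) (cong (List.sum (h x) +_) (sum-concatMap h xs))

sum-map-tabulate : ∀ {a} {A : Set a} {n} (g : A → ℕ) (f : Fin n → A) → List.sum (map g (tabulate f)) ≡ ∑[ i < n ] g (f i)
sum-map-tabulate {n = zero} g f = refl
sum-map-tabulate {n = suc n} g f = cong (g (f zero) +_) (sum-map-tabulate g (f ∘ suc))

sum-map-allVec : ∀ {n} k (g : Vec (Fin n) k → ℕ) → List.sum (map g (allVec n k)) ≡ ∑ᵛ k g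
sum-map-allVec zero g = +-identityʳ (g [])
sum-map-allVec {n} (suc k) g = begin
  List.sum (map g (concatMap (λ i → map (i ∷_) (allVec n k)) (allFin n)))
    ≡⟨ cong List.sum (map-concatMap g _ (allFin n)) ⟩
  List.sum (concatMap (λ i → map g (map (i ∷_) (allVec n k))) (allFin n))
    ≡⟨ sum-concatMap _ (allFin n) ⟩
  List.sum (map (λ i → List.sum (map g (map (i ∷_) (allVec n k)))) (allFin n))
    ≡⟨ sum-map-tabulate (λ i → List.sum (map g (map (i ∷_) (allVec n k)))) id ⟩
  ∑[ i < n ] List.sum (map g (map (i ∷_) (allVec n k)))
    ≡⟨ sum-cong-≗ (λ i → trans (cong List.sum (sym (map-∘ (allVec n k)))) (sum-map-allVec k (λ xs → g (i ∷ xs)))) ⟩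
  ∑ᵛ (suc k) g ∎
  where open ≡-Reasoning

count-allVec : ∀ {n k p} {P : Pred (Vec (Fin n) k) p} (P? : Decidable P) →
  length (filter P? (allVec n k)) ≡ ∑ᵛ k (λ x → 𝟙 (does (P? x)))
count-allVec {n} {k} P? = trans (length-filter≡sum P? (allVec n k)) (sum-map-allVec k _)

module _ {a} {X : Set a} where

  headOr : ∀ {m} → Vec X m → X → X
  headOr [] v = v
  headOr (y ∷ _) _ = y

  next : ∀ {m} → Vec X m → X → Fin m → X
  next (_ ∷ ys) v zero = headOr ys v
  next (_ ∷ ys) v (suc t) = next ys v t

  next-inner : ∀ {m} (ys : Vec X m) v (t s : Fin m) → toℕ s ≡ suc (toℕ t) → next ys v t ≡ lookup ys s
  next-inner (_ ∷ _ ∷ _) v zero (suc zero) _ = refl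
  next-inner (_ ∷ ys) v (suc t) (suc s) s≡1+t = next-inner ys v t s (suc-injective s≡1+t)

  next-last : ∀ {m} (ys : Vec X m) v (t : Fin m) → suc (toℕ t) ≡ m → next ys v t ≡ v
  next-last (_ ∷ []) v zero _ = refl
  next-last (_ ∷ ys) v (suc t) t≡last = next-last ys v t (suc-injective t≡last)

  lookup-cyc : ∀ {k} (xs : Vec X (suc k)) t → lookup xs (cyc t) ≡ next xs (lookup xs zero) t
  lookup-cyc {k} xs t with suc (toℕ t) <? suc k
  ... | yes t<k = sym (next-inner xs _ t (cyc t) (trans (Fin.toℕ-fromℕ< _) (m<n⇒m%n≡m t<k)))
  ... | no t≮k = trans (cong (lookup xs) cyc-last) (sym (next-last xs _ t t≡k))
    where
    t≡k : suc (toℕ t) ≡ suc k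
    t≡k = ≤-antisym (Fin.toℕ<n t) (≮⇒≥ t≮k)
    cyc-last : cyc t ≡ zero
    cyc-last = Fin.toℕ-injective (trans (Fin.toℕ-fromℕ< _) (trans (cong (_% suc k) t≡k) (n%n≡0 (suc k))))

module _ {n : ℕ} (A : Matrix n) where

  scaled : (Fin n → ℕ) → Matrix n
  scaled p u v = p u * A u v

  scaled≋diag-· : ∀ p → scaled p ≋ diag p · A
  scaled≋diag-· p = ≋-sym (diag-· p A)

  walkMatrix : ∀ {k} → (Fin k → Fin n → ℕ) → Matrix n
  walkMatrix {zero} _ = I
  walkMatrix {suc k} q = scaled (q zero) · walkMatrix (q ∘ suc)

  closedWalkWeight : ∀ {k} → (Fin k → Fin n → ℕ) → Vec (Fin n) k → ℕ
  closedWalkWeight q xs = ∏ (λ t → q t (lookup xs t) * A (lookup xs t) (lookup xs (cyc t)))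

  openWalkWeight : ∀ {k} → (Fin k → Fin n → ℕ) → Vec (Fin n) k → Fin n → ℕ
  openWalkWeight q xs v = ∏ (λ t → q t (lookup xs t) * A (lookup xs t) (next xs v t))

  ∑ᵛ-openWalkWeight : ∀ k (q : Fin (suc k) → Fin n → ℕ) u v →
    ∑ᵛ k (λ ys → openWalkWeight q (u ∷ ys) v) ≡ walkMatrix q u v
  ∑ᵛ-openWalkWeight zero q u v = trans (*-identityʳ _) (sym (·-identityʳ (scaled (q zero)) u v))
  ∑ᵛ-openWalkWeight (suc k) q u v = sum-cong-≗ λ i →
    trans (sym (*-distribˡ-∑ᵛ k (scaled (q zero) u i) (λ ys → openWalkWeight (q ∘ suc) (i ∷ ys) v)))
          (cong (scaled (q zero) u i *_) (∑ᵛ-openWalkWeight k (q ∘ suc) i v))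

  ∑ᵛ-closedWalkWeight : ∀ k (q : Fin (suc k) → Fin n → ℕ) → ∑ᵛ (suc k) (closedWalkWeight q) ≡ tr (walkMatrix q)
  ∑ᵛ-closedWalkWeight k q = sum-cong-≗ λ u → trans
    (∑ᵛ-cong k (λ ys → ∏-cong (λ t → cong (q t (lookup (u ∷ ys) t) *_) (cong (A (lookup (u ∷ ys) t)) (lookup-cyc (u ∷ ys) t)))))
    (∑ᵛ-openWalkWeight k q u u)

  scaled-cong : ∀ {p p′} → (∀ u → p u ≡ p′ u) → scaled p ≋ scaled p′
  scaled-cong p≗p′ u w = cong (_* A u w) (p≗p′ u)

  scaled-1 : ∀ {p} → (∀ u → p u ≡ 1) → scaled p ≋ A
  scaled-1 p≡1 u w = trans (scaled-cong p≡1 u w) (*-identityˡ (A u w))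

  walkMatrix-unmarked : ∀ {k} (q : Fin k → Fin n → ℕ) → (∀ t u → q t u ≡ 1) → walkMatrix q ≋ A ^ᴹ k
  walkMatrix-unmarked {zero} _ _ = ≋-refl
  walkMatrix-unmarked {suc k} q q≡1 = ·-cong (scaled-1 (q≡1 zero)) (walkMatrix-unmarked (q ∘ suc) (q≡1 ∘ suc))

  walkMatrix-marked₁ : ∀ {k} (q : Fin k → Fin n → ℕ) i p → i < k →
    (∀ t u → toℕ t ≡ i → q t u ≡ p u) → (∀ t u → toℕ t ≢ i → q t u ≡ 1) →
    walkMatrix q ≋ A ^ᴹ i · scaled p · A ^ᴹ (k ∸ suc i)
  walkMatrix-marked₁ {suc k} q zero p _ marked unmarked = begin
    scaled (q zero) · walkMatrix (q ∘ suc)  ≈⟨ ·-cong (scaled-cong (λ u → marked zero u refl)) rest ⟩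
    scaled p · A ^ᴹ k                       ≈⟨ ·-identityˡ _ ⟨
    I · scaled p · A ^ᴹ k                   ∎
    where
    open ≋-Reasoning
    rest = walkMatrix-unmarked (q ∘ suc) (λ t u → unmarked (suc t) u λ ())
  walkMatrix-marked₁ {suc k} q (suc i) p (s≤s i<k) marked unmarked = begin
    scaled (q zero) · walkMatrix (q ∘ suc)      ≈⟨ ·-cong (scaled-1 (λ u → unmarked zero u λ ())) rest ⟩
    A · A ^ᴹ i · scaled p · A ^ᴹ (k ∸ suc i)    ≈⟨ ·-assoc A (A ^ᴹ i) _ ⟨
    (A · A ^ᴹ i) · scaled p · A ^ᴹ (k ∸ suc i)  ∎
    where
    open ≋-Reasoning
    rest = walkMatrix-marked₁ (q ∘ suc) i p i<k (λ t u → marked (suc t) u ∘ cong suc)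
      (λ t u t≢i → unmarked (suc t) u (t≢i ∘ suc-injective))

  walkMatrix-marked₂ : ∀ {k} (q : Fin k → Fin n → ℕ) i j p → i < j → j < k →
    (∀ t u → toℕ t ≡ i ⊎ toℕ t ≡ j → q t u ≡ p u) → (∀ t u → toℕ t ≢ i → toℕ t ≢ j → q t u ≡ 1) →
    walkMatrix q ≋ A ^ᴹ i · scaled p · A ^ᴹ (j ∸ suc i) · scaled p · A ^ᴹ (k ∸ suc j)
  walkMatrix-marked₂ {suc k} q zero (suc j) p _ (s≤s j<k) marked unmarked = begin
    scaled (q zero) · walkMatrix (q ∘ suc)              ≈⟨ ·-cong (scaled-cong (λ u → marked zero u (inj₁ refl))) rest ⟩
    scaled p · A ^ᴹ j · scaled p · A ^ᴹ (k ∸ suc j)      ≈⟨ ·-identityˡ _ ⟨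
    I · scaled p · A ^ᴹ j · scaled p · A ^ᴹ (k ∸ suc j)  ∎
    where
    open ≋-Reasoning
    rest = walkMatrix-marked₁ (q ∘ suc) j p j<k (λ t u → marked (suc t) u ∘ inj₂ ∘ cong suc)
      (λ t u t≢j → unmarked (suc t) u (λ ()) (t≢j ∘ suc-injective))
  walkMatrix-marked₂ {suc k} q (suc i) (suc j) p (s≤s i<j) (s≤s j<k) marked unmarked = begin
    scaled (q zero) · walkMatrix (q ∘ suc)                                   ≈⟨ ·-cong (scaled-1 (λ u → unmarked zero u (λ ()) (λ ()))) rest ⟩
    A · A ^ᴹ i · scaled p · A ^ᴹ (j ∸ suc i) · scaled p · A ^ᴹ (k ∸ suc j)    ≈⟨ ·-assoc A (A ^ᴹ i) _ ⟨
    (A · A ^ᴹ i) · scaled p · A ^ᴹ (j ∸ suc i) · scaled p · A ^ᴹ (k ∸ suc j)  ∎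
    where
    open ≋-Reasoning
    rest = walkMatrix-marked₂ (q ∘ suc) i j p i<j j<k (λ t u → marked (suc t) u ∘ Sum.map (cong suc) (cong suc))
      (λ t u t≢i t≢j → unmarked (suc t) u (t≢i ∘ suc-injective) (t≢j ∘ suc-injective))

  tr-marked₂ : ∀ i a b p → tr (A ^ᴹ i · scaled p · A ^ᴹ a · scaled p · A ^ᴹ b) ≡ markedTrace A p (suc a) (suc (b + i))
  tr-marked₂ i a b p = trans (tr-·-comm (A ^ᴹ i) _) (tr-cong (begin
    (S · A ^ᴹ a · S · A ^ᴹ b) · A ^ᴹ i       ≈⟨ ·-assoc S _ _ ⟩
    S · (A ^ᴹ a · S · A ^ᴹ b) · A ^ᴹ i       ≈⟨ ·-congʳ S (·-assoc (A ^ᴹ a) _ _) ⟩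
    S · A ^ᴹ a · (S · A ^ᴹ b) · A ^ᴹ i       ≈⟨ ·-congʳ S (·-congʳ (A ^ᴹ a) (·-assoc S _ _)) ⟩
    S · A ^ᴹ a · S · A ^ᴹ b · A ^ᴹ i         ≈⟨ ·-congʳ S (·-congʳ (A ^ᴹ a) (·-congʳ S (^ᴹ-+ A b i))) ⟨
    S · A ^ᴹ a · S · A ^ᴹ (b + i)            ≈⟨ ·-congʳ S (·-congʳ (A ^ᴹ a) (shift (A ^ᴹ (b + i)))) ⟩
    S · A ^ᴹ a · diag p · A ^ᴹ suc (b + i)   ≈⟨ shift _ ⟩
    diag p · A · A ^ᴹ a · diag p · A ^ᴹ suc (b + i)  ≈⟨ ·-congʳ (diag p) (·-assoc A _ _) ⟨
    diag p · A ^ᴹ suc a · diag p · A ^ᴹ suc (b + i)  ∎))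
    where
    open ≋-Reasoning
    S = scaled p
    shift : ∀ M → S · M ≋ diag p · A · M
    shift M = ≋-trans (·-congˡ M (scaled≋diag-· p)) (·-assoc (diag p) A M)

  tr-walkMatrix-marked₂ : ∀ {k} (q : Fin k → Fin n → ℕ) i j p → (i<j : i < j) → (j<k : j < k) →
    (∀ t u → toℕ t ≡ i ⊎ toℕ t ≡ j → q t u ≡ p u) → (∀ t u → toℕ t ≢ i → toℕ t ≢ j → q t u ≡ 1) →
    tr (walkMatrix q) ≡ markedTrace A p (j ∸ i) (k ∸ (j ∸ i))
  tr-walkMatrix-marked₂ {k} q i j p i<j j<k marked unmarked = begin
    tr (walkMatrix q)                                       ≡⟨ tr-cong (walkMatrix-marked₂ q i j p i<j j<k marked unmarked) ⟩
    tr (A ^ᴹ i · scaled p · A ^ᴹ (j ∸ suc i) · scaled p · A ^ᴹ (k ∸ suc j)) ≡⟨ tr-marked₂ i (j ∸ suc i) (k ∸ suc j) p ⟩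
    markedTrace A p (suc (j ∸ suc i)) (suc (k ∸ suc j + i)) ≡⟨ cong₂ (markedTrace A p) (+-∸-assoc 1 i<j) gap ⟨
    markedTrace A p (j ∸ i) (k ∸ (j ∸ i))                   ∎
    where
    open ≡-Reasoning
    i≤j = <⇒≤ i<j
    gap : k ∸ (j ∸ i) ≡ suc (k ∸ suc j + i)
    gap = begin
      k ∸ (j ∸ i)             ≡⟨ [m+n]∸[m+o]≡n∸o i k (j ∸ i) ⟨
      i + k ∸ (i + (j ∸ i))   ≡⟨ cong₂ _∸_ (+-comm i k) (m+[n∸m]≡n i≤j) ⟩
      k + i ∸ j               ≡⟨ +-∸-comm i (<⇒≤ j<k) ⟩
      k ∸ j + i               ≡⟨ cong (_+ i) (+-∸-assoc 1 j<k) ⟩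
      suc (k ∸ suc j) + i     ∎

-- Graphs and diverse colourings

≤-foldr-⊔ : ∀ {a} {X : Set a} {k} (g : X → ℕ) (f : Fin k → X) i → g (f i) ≤ foldr _⊔_ 0 (map g (tabulate f))
≤-foldr-⊔ g f zero = m≤m⊔n _ _
≤-foldr-⊔ g f (suc i) = ≤-trans (≤-foldr-⊔ g (f ∘ suc) i) (m≤n⊔m _ _)

∑-𝟙-∈ : ∀ {m} (s : Subset m) → ∑[ c < m ] 𝟙 (does (c ∈? s)) ≡ ∣ s ∣
∑-𝟙-∈ {zero} [] = refl
∑-𝟙-∈ {suc m} (true ∷ s) = cong suc (∑-𝟙-∈ s)
∑-𝟙-∈ {suc m} (false ∷ s) = ∑-𝟙-∈ s

Disjoint⇒∉ : ∀ {m} {s t : Subset m} {c} → Disjoint s t → c ∈ s → c ∉ t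
Disjoint⇒∉ {s = s} {t} s∩t≡⊥ c∈s c∈t = ∉⊥ (subst (_ ∈_) s∩t≡⊥ (x∈p∩q⁺ (c∈s , c∈t)))

¬Disjoint⇒common : ∀ {m} (s t : Subset m) → ¬ Disjoint s t → ∃[ c ] (c ∈ s × c ∈ t)
¬Disjoint⇒common s t ¬disjoint with nonempty? (s ∩ t)
... | yes (c , c∈s∩t) = c , x∈p∩q⁻ s t c∈s∩t
... | no empty = ⊥-elim (¬disjoint (Empty-unique empty))

module _ {n : ℕ} (G : Graph n) where

  adjacency : Matrix n
  adjacency u v = 𝟙 (adj G u v)

  adjacency-symmetric : Symmetric adjacency
  adjacency-symmetric u v = cong 𝟙 (Graph.sym G v u)

  deg≤Δ : ∀ u → deg G u ≤ Δ G
  deg≤Δ = ≤-foldr-⊔ (deg G) id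

  adjacency²-diag : ∀ u → (adjacency · adjacency) u u ≡ deg G u
  adjacency²-diag u = begin
    ∑[ w < n ] (𝟙 (adj G u w) * 𝟙 (adj G w u))   ≡⟨ sum-cong-≗ (λ w → cong (λ b → 𝟙 (adj G u w) * 𝟙 b) (Graph.sym G w u)) ⟩
    ∑[ w < n ] (𝟙 (adj G u w) * 𝟙 (adj G u w))   ≡⟨ sum-cong-≗ (λ w → 𝟙-idem (adj G u w)) ⟩
    ∑[ w < n ] 𝟙 (does (adj G u w Bool.≟ true))  ≡⟨ sum-map-tabulate (λ w → 𝟙 (does (adj G u w Bool.≟ true))) id ⟨
    List.sum (map (λ w → 𝟙 (does (adj G u w Bool.≟ true))) (allFin n))
                                                 ≡⟨ length-filter≡sum (λ w → adj G u w Bool.≟ true) (allFin n) ⟨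
    deg G u                                      ∎
    where
    open ≡-Reasoning
    𝟙-idem : ∀ b → 𝟙 b * 𝟙 b ≡ 𝟙 (does (b Bool.≟ true))
    𝟙-idem true = refl
    𝟙-idem false = refl

  unweighted : ∀ {k} → Fin k → Fin n → ℕ
  unweighted _ _ = 1

  unweightedWalk≤𝟙-IsHom : ∀ {k} (xs : Vec (Fin n) k) → closedWalkWeight adjacency unweighted xs ≤ 𝟙 (does (IsHom? G xs))
  unweightedWalk≤𝟙-IsHom {k} xs = bound (IsHom? G xs)
    where
    step : Fin k → ℕ
    step t = 1 * adjacency (lookup xs t) (lookup xs (cyc t))
    bound : (hom? : Dec (IsHom G xs)) → ∏ step ≤ 𝟙 (does hom?)
    bound (yes _) = ∏-≤1 step (λ t → ≤-trans (≤-reflexive (*-identityˡ _)) (𝟙≤1 _))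
    bound (no ¬hom) with Fin.¬∀⟶∃¬ k _ (λ t → adj G (lookup xs t) (lookup xs (cyc t)) Bool.≟ true) ¬hom
    ... | t , ¬edge = ≤-reflexive (∏-zero step t (cong (λ b → 1 * 𝟙 b) (Bool.¬-not ¬edge)))

  tr-adjacency^≤hom : ∀ {k} → 1 ≤ k → tr (adjacency ^ᴹ k) ≤ hom k G
  tr-adjacency^≤hom {suc k} _ = begin
    tr (adjacency ^ᴹ suc k)                                       ≡⟨ tr-cong (walkMatrix-unmarked adjacency {suc k} unweighted (λ _ _ → refl)) ⟨
    tr (walkMatrix adjacency (unweighted {suc k}))               ≡⟨ ∑ᵛ-closedWalkWeight adjacency k (unweighted {suc k}) ⟨
    ∑ᵛ (suc k) (closedWalkWeight adjacency unweighted)           ≤⟨ ∑ᵛ-mono-≤ (suc k) unweightedWalk≤𝟙-IsHom ⟩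
    ∑ᵛ (suc k) (λ xs → 𝟙 (does (IsHom? G xs)))                    ≡⟨ count-allVec {k = suc k} (IsHom? G) ⟨
    hom (suc k) G                                                 ∎
    where open ≤-Reasoning

module _ {n m : ℕ} (G : Graph n) (f : Fin n → Subset m) where

  colourClass : Fin m → Fin n → ℕ
  colourClass c u = 𝟙 (does (c ∈? f u))

  colourClass-sandwich : ∀ c u v x → (c ∈ f u → c ∈ f v → x ≡ 0) → colourClass c u * x * colourClass c v ≡ 0
  colourClass-sandwich c u v x x≡0 with c ∈? f u | c ∈? f v
  ... | yes c∈fu | yes c∈fv = cong (λ x → 1 * x * 1) (x≡0 c∈fu c∈fv)
  ... | yes _ | no _ = *-zeroʳ (1 * x)
  ... | no _ | _ = refl

  module _ (diverse : Diverse G f) where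

    private
      A = adjacency G

    colourClass-adjacent : ∀ c u v → colourClass c u * A u v * colourClass c v ≡ 0
    colourClass-adjacent c u v = colourClass-sandwich c u v (A u v) no-edge
      where
      no-edge : c ∈ f u → c ∈ f v → 𝟙 (adj G u v) ≡ 0
      no-edge c∈fu c∈fv with u Fin.≟ v
      ... | yes refl = cong 𝟙 (Graph.irrefl G u)
      ... | no u≢v = cong 𝟙 (Bool.¬-not λ uv → Disjoint⇒∉ (diverse u v u≢v (inj₁ uv)) c∈fu c∈fv)

    colourClass-common-neighbour : ∀ c u v → u ≢ v → colourClass c u * (A · A) u v * colourClass c v ≡ 0
    colourClass-common-neighbour c u v u≢v = colourClass-sandwich c u v ((A · A) u v) λ c∈fu c∈fv →
      trans (sum-cong-≗ (λ w → 𝟙-*-zero _ _ λ uw wv → Disjoint⇒∉ (diverse u v u≢v (inj₂ (w , uw , wv))) c∈fu c∈fv))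
            (sum-replicate-zero n)

    markedTrace-1 : ∀ c y → markedTrace A (colourClass c) 1 y ≡ 0
    markedTrace-1 c y = begin
      tr (D · A ^ᴹ 1 · D · A ^ᴹ y)                                     ≡⟨ tr-cong (·-congʳ D (·-congˡ _ (·-identityʳ A))) ⟩
      tr (D · A · D · A ^ᴹ y)                                          ≡⟨ sum-cong-≗ (diag-sandwich χ A (A ^ᴹ y)) ⟩
      ∑[ u < n ] ∑[ w < n ] (χ u * A u w * χ w * (A ^ᴹ y) w u)         ≡⟨ sum-cong-≗ (λ u → sum-cong-≗ (λ w → cong (_* (A ^ᴹ y) w u) (colourClass-adjacent c u w))) ⟩
      ∑[ u < n ] ∑[ w < n ] 0                                          ≡⟨ sum-cong-≗ {n} {λ _ → ∑[ w < n ] 0} (λ _ → sum-replicate-zero n) ⟩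
      ∑[ u < n ] 0                                                     ≡⟨ sum-replicate-zero n ⟩
      0                                                                ∎
      where
      open ≡-Reasoning
      χ = colourClass c
      D = diag χ

    markedTrace-2 : ∀ c y → markedTrace A (colourClass c) 2 y ≤ ∑[ u < n ] (colourClass c u * Δ G * (A ^ᴹ y) u u)
    markedTrace-2 c y = ∑-mono-≤ λ u → begin
      (D · A ^ᴹ 2 · D · A ^ᴹ y) u u                         ≡⟨ ·-congʳ D (·-congˡ (D · A ^ᴹ y) (·-congʳ A (·-identityʳ A))) u u ⟩
      (D · (A · A) · D · A ^ᴹ y) u u                        ≡⟨ diag-sandwich χ (A · A) (A ^ᴹ y) u ⟩
      ∑[ w < n ] (χ u * (A · A) u w * χ w * (A ^ᴹ y) w u)   ≡⟨ ∑-single (λ w → χ u * (A · A) u w * χ w * (A ^ᴹ y) w u) u (λ w w≢u → cong (_* (A ^ᴹ y) w u) (colourClass-common-neighbour c u w (w≢u ∘ sym))) ⟩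
      χ u * (A · A) u u * χ u * (A ^ᴹ y) u u                ≡⟨ cong (_* (A ^ᴹ y) u u) (𝟙-sandwich (does (c ∈? f u)) ((A · A) u u)) ⟩
      χ u * (A · A) u u * (A ^ᴹ y) u u                      ≤⟨ *-monoˡ-≤ ((A ^ᴹ y) u u) (*-monoʳ-≤ (χ u) (≤-trans (≤-reflexive (adjacency²-diag G u)) (deg≤Δ G u))) ⟩
      χ u * Δ G * (A ^ᴹ y) u u                              ∎
      where
      open ≤-Reasoning
      χ = colourClass c
      D = diag χ

    ∑-markedTrace-2 : ∀ r → (∀ v → ∣ f v ∣ ≡ r) → ∀ y → ∑[ c < m ] markedTrace A (colourClass c) 2 y ≤ r * Δ G * tr (A ^ᴹ y)
    ∑-markedTrace-2 r ∣f∣≡r y = begin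
      ∑[ c < m ] markedTrace A (colourClass c) 2 y                  ≤⟨ ∑-mono-≤ (λ c → markedTrace-2 c y) ⟩
      ∑[ c < m ] ∑[ u < n ] (colourClass c u * Δ G * (A ^ᴹ y) u u) ≡⟨ ∑-comm (λ c u → colourClass c u * Δ G * (A ^ᴹ y) u u) ⟩
      ∑[ u < n ] ∑[ c < m ] (colourClass c u * Δ G * (A ^ᴹ y) u u) ≡⟨ sum-cong-≗ (λ u → trans (sum-cong-≗ (λ c → *-assoc (colourClass c u) (Δ G) _)) (sym (*-distribʳ-sum (Δ G * (A ^ᴹ y) u u) (λ c → colourClass c u)))) ⟩
      ∑[ u < n ] (∑[ c < m ] colourClass c u * (Δ G * (A ^ᴹ y) u u)) ≡⟨ sum-cong-≗ (λ u → cong (_* (Δ G * (A ^ᴹ y) u u)) (trans (∑-𝟙-∈ (f u)) (∣f∣≡r u))) ⟩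
      ∑[ u < n ] (r * (Δ G * (A ^ᴹ y) u u))                         ≡⟨ *-distribˡ-sum r (λ u → Δ G * (A ^ᴹ y) u u) ⟨
      r * ∑[ u < n ] (Δ G * (A ^ᴹ y) u u)                           ≡⟨ cong (r *_) (*-distribˡ-sum (Δ G) (λ u → (A ^ᴹ y) u u)) ⟨
      r * (Δ G * tr (A ^ᴹ y))                                       ≡⟨ *-assoc r (Δ G) (tr (A ^ᴹ y)) ⟨
      r * Δ G * tr (A ^ᴹ y)                                         ∎
      where open ≤-Reasoning

-- Counting non-rainbow walks

twoMarks : ∀ {n k} → (Fin n → ℕ) → Fin k → Fin k → Fin k → Fin n → ℕ
twoMarks p i j t with t Fin.≟ i | t Fin.≟ j
... | yes _ | _ = p
... | no _ | yes _ = p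
... | no _ | no _ = λ _ → 1

module _ {n k : ℕ} (p : Fin n → ℕ) (i j : Fin k) where

  twoMarks-marked : ∀ t u → toℕ t ≡ toℕ i ⊎ toℕ t ≡ toℕ j → twoMarks p i j t u ≡ p u
  twoMarks-marked t u t∈ij with t Fin.≟ i | t Fin.≟ j | t∈ij
  ... | yes _ | _ | _ = refl
  ... | no _ | yes _ | _ = refl
  ... | no t≢i | no _ | inj₁ t≡i = ⊥-elim (t≢i (Fin.toℕ-injective t≡i))
  ... | no _ | no t≢j | inj₂ t≡j = ⊥-elim (t≢j (Fin.toℕ-injective t≡j))

  twoMarks-unmarked : ∀ t u → toℕ t ≢ toℕ i → toℕ t ≢ toℕ j → twoMarks p i j t u ≡ 1
  twoMarks-unmarked t u t≢i t≢j with t Fin.≟ i | t Fin.≟ j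
  ... | yes t≡i | _ = ⊥-elim (t≢i (cong toℕ t≡i))
  ... | no _ | yes t≡j = ⊥-elim (t≢j (cong toℕ t≡j))
  ... | no _ | no _ = refl

  twoMarks-pos : ∀ (xs : Vec (Fin n) k) → 1 ≤ p (lookup xs i) → 1 ≤ p (lookup xs j) → ∀ t → 1 ≤ twoMarks p i j t (lookup xs t)
  twoMarks-pos xs 1≤pi 1≤pj t with t Fin.≟ i | t Fin.≟ j
  ... | yes refl | _ = 1≤pi
  ... | no _ | yes refl = 1≤pj
  ... | no _ | no _ = ≤-refl

module _ {n m : ℕ} (G : Graph n) (f : Fin n → Subset m) where

  private
    A = adjacency G
    χ = colourClass G f

  ¬Rainbow⇒overlap : ∀ {k} (xs : Vec (Fin n) k) → ¬ Rainbow f xs →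
    ∃[ i ] ∃[ j ] (i ≢ j × ¬ Disjoint (f (lookup xs i)) (f (lookup xs j)))
  ¬Rainbow⇒overlap {k} xs ¬rainbow =
    let i , ¬∀j = Fin.¬∀⟶∃¬ k _ (λ i → Fin.all? (separated? i)) ¬rainbow
        j , ¬separated = Fin.¬∀⟶∃¬ k _ (separated? i) ¬∀j
    in i , j , (λ i≡j → ¬separated (λ i≢j → ⊥-elim (i≢j i≡j))) , (λ disjoint → ¬separated (λ _ → disjoint))
    where
    separated? : ∀ i j → Dec (i ≢ j → Disjoint (f (lookup xs i)) (f (lookup xs j)))
    separated? i j = ¬? (i Fin.≟ j) →-dec Disjoint? (f (lookup xs i)) (f (lookup xs j))

  ¬Rainbow⇒sharedColour : ∀ {k} (xs : Vec (Fin n) k) → ¬ Rainbow f xs →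
    ∃[ i ] ∃[ j ] ∃[ c ] (toℕ i < toℕ j × c ∈ f (lookup xs i) × c ∈ f (lookup xs j))
  ¬Rainbow⇒sharedColour xs ¬rainbow with ¬Rainbow⇒overlap xs ¬rainbow
  ... | i , j , i≢j , ¬disjoint with <-cmp (toℕ i) (toℕ j) | ¬Disjoint⇒common (f (lookup xs i)) (f (lookup xs j)) ¬disjoint
  ...   | tri< i<j _ _ | c , c∈i , c∈j = i , j , c , i<j , c∈i , c∈j
  ...   | tri≈ _ i≡j _ | _ = ⊥-elim (i≢j (Fin.toℕ-injective i≡j))
  ...   | tri> _ _ j<i | c , c∈i , c∈j = j , i , c , j<i , c∈j , c∈i

  sharedColourWeight : ∀ {k} → Fin k → Fin k → Vec (Fin n) k → ℕ
  sharedColourWeight i j xs = 𝟙 (does (i Fin.<? j)) * ∑[ c < m ] closedWalkWeight A (twoMarks (χ c) i j) xs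

  1≤closedWalkWeight-twoMarks : ∀ {k} (xs : Vec (Fin n) k) i j c → IsHom G xs →
    c ∈ f (lookup xs i) → c ∈ f (lookup xs j) → 1 ≤ closedWalkWeight A (twoMarks (χ c) i j) xs
  1≤closedWalkWeight-twoMarks xs i j c hom c∈i c∈j =
    1≤∏ (λ t → twoMarks (χ c) i j t (lookup xs t) * A (lookup xs t) (lookup xs (cyc t)))
      (λ t → *-mono-≤ (twoMarks-pos (χ c) i j xs (1≤χ c∈i) (1≤χ c∈j) t) (≤-reflexive (sym (cong 𝟙 (hom t)))))
    where
    1≤χ : ∀ {u} → c ∈ f u → 1 ≤ χ c u
    1≤χ {u} c∈fu = ≤-reflexive (sym (𝟙-dec-yes (c ∈? f u) c∈fu))

  1≤∑-sharedColourWeight : ∀ {k} (xs : Vec (Fin n) k) → IsHom G xs → ¬ Rainbow f xs →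
    1 ≤ ∑[ i < k ] ∑[ j < k ] sharedColourWeight i j xs
  1≤∑-sharedColourWeight {k} xs hom ¬rainbow with ¬Rainbow⇒sharedColour xs ¬rainbow
  ... | i , j , c , i<j , c∈i , c∈j = begin
    1                                                ≤⟨ 1≤closedWalkWeight-twoMarks xs i j c hom c∈i c∈j ⟩
    W c                                              ≤⟨ ≤-∑ W c ⟩
    ∑[ c < m ] W c                                   ≡⟨ *-identityˡ (∑[ c < m ] W c) ⟨
    1 * ∑[ c < m ] W c                               ≡⟨ cong (_* ∑[ c < m ] W c) (𝟙-dec-yes (i Fin.<? j) i<j) ⟨
    sharedColourWeight i j xs                        ≤⟨ ≤-∑ (λ j → sharedColourWeight i j xs) j ⟩
    ∑[ j < k ] sharedColourWeight i j xs             ≤⟨ ≤-∑ (λ i → ∑[ j < k ] sharedColourWeight i j xs) i ⟩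
    ∑[ i < k ] ∑[ j < k ] sharedColourWeight i j xs  ∎
    where
    open ≤-Reasoning
    W : Fin m → ℕ
    W c = closedWalkWeight A (twoMarks (χ c) i j) xs

  𝟙-nonRainbowHom≤ : ∀ {k} (xs : Vec (Fin n) k) →
    𝟙 (does (IsHom? G xs ×-dec ¬? (Rainbow? f xs))) ≤ ∑[ i < k ] ∑[ j < k ] sharedColourWeight i j xs
  𝟙-nonRainbowHom≤ xs = bound (IsHom? G xs ×-dec ¬? (Rainbow? f xs))
    where
    bound : ∀ (bad? : Dec (IsHom G xs × ¬ Rainbow f xs)) → 𝟙 (does bad?) ≤ ∑[ i < _ ] ∑[ j < _ ] sharedColourWeight i j xs
    bound (yes (hom , ¬rainbow)) = 1≤∑-sharedColourWeight xs hom ¬rainbow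
    bound (no _) = z≤n

  colourTrace : ℕ → ℕ → ℕ
  colourTrace L d = ∑[ c < m ] markedTrace A (χ c) d (L ∸ d)

  ∑ᵛ-twoMarks : ∀ {k} p (i j : Fin (suc k)) → toℕ i < toℕ j →
    ∑ᵛ (suc k) (closedWalkWeight A (twoMarks p i j)) ≡ markedTrace A p (toℕ j ∸ toℕ i) (suc k ∸ (toℕ j ∸ toℕ i))
  ∑ᵛ-twoMarks {k} p i j i<j = trans (∑ᵛ-closedWalkWeight A k (twoMarks p i j))
    (tr-walkMatrix-marked₂ A (twoMarks p i j) (toℕ i) (toℕ j) p i<j (Fin.toℕ<n j) (twoMarks-marked p i j) (twoMarks-unmarked p i j))

  ∑ᵛ-sharedColourWeight : ∀ {k} (i j : Fin (suc k)) →
    ∑ᵛ (suc k) (sharedColourWeight i j) ≡ 𝟙 (does (i Fin.<? j)) * colourTrace (suc k) (toℕ j ∸ toℕ i)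
  ∑ᵛ-sharedColourWeight {k} i j = begin
    ∑ᵛ (suc k) (sharedColourWeight i j)                                      ≡⟨ *-distribˡ-∑ᵛ (suc k) (𝟙 (does (i Fin.<? j))) (λ xs → ∑[ c < m ] W c xs) ⟨
    𝟙 (does (i Fin.<? j)) * ∑ᵛ (suc k) (λ xs → ∑[ c < m ] W c xs)            ≡⟨ cong (𝟙 (does (i Fin.<? j)) *_) (∑ᵛ-∑-comm (suc k) W) ⟩
    𝟙 (does (i Fin.<? j)) * ∑[ c < m ] ∑ᵛ (suc k) (W c)                      ≡⟨ traces (i Fin.<? j) ⟩
    𝟙 (does (i Fin.<? j)) * colourTrace (suc k) (toℕ j ∸ toℕ i)              ∎
    where
    open ≡-Reasoning
    W : Fin m → Vec (Fin n) (suc k) → ℕ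
    W c = closedWalkWeight A (twoMarks (χ c) i j)
    traces : (i<?j : Dec (toℕ i < toℕ j)) →
      𝟙 (does i<?j) * ∑[ c < m ] ∑ᵛ (suc k) (W c) ≡ 𝟙 (does i<?j) * colourTrace (suc k) (toℕ j ∸ toℕ i)
    traces (yes i<j) = cong (1 *_) (sum-cong-≗ (λ c → ∑ᵛ-twoMarks (χ c) i j i<j))
    traces (no _) = refl

  nonRainbowHom≤∑colourTrace : ∀ k → nonRainbowHom (suc k) G f ≤
    ∑[ i < suc k ] ∑[ j < suc k ] (𝟙 (does (i Fin.<? j)) * colourTrace (suc k) (toℕ j ∸ toℕ i))
  nonRainbowHom≤∑colourTrace k = begin
    nonRainbowHom (suc k) G f                                              ≡⟨ count-allVec {k = suc k} (λ xs → IsHom? G xs ×-dec ¬? (Rainbow? f xs)) ⟩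
    ∑ᵛ (suc k) (λ xs → 𝟙 (does (IsHom? G xs ×-dec ¬? (Rainbow? f xs))))    ≤⟨ ∑ᵛ-mono-≤ (suc k) 𝟙-nonRainbowHom≤ ⟩
    ∑ᵛ (suc k) (λ xs → ∑[ i < suc k ] ∑[ j < suc k ] sharedColourWeight i j xs)
      ≡⟨ ∑ᵛ-∑-comm (suc k) (λ i xs → ∑[ j < suc k ] sharedColourWeight i j xs) ⟩
    ∑[ i < suc k ] ∑ᵛ (suc k) (λ xs → ∑[ j < suc k ] sharedColourWeight i j xs)
      ≡⟨ sum-cong-≗ (λ i → trans (∑ᵛ-∑-comm (suc k) (sharedColourWeight i)) (sum-cong-≗ (∑ᵛ-sharedColourWeight i))) ⟩
    ∑[ i < suc k ] ∑[ j < suc k ] (𝟙 (does (i Fin.<? j)) * colourTrace (suc k) (toℕ j ∸ toℕ i)) ∎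
    where open ≤-Reasoning

  nonRainbowHom≤hom : ∀ k → nonRainbowHom k G f ≤ hom k G
  nonRainbowHom≤hom k = begin
    nonRainbowHom k G f                                                ≡⟨ count-allVec {k = k} (λ xs → IsHom? G xs ×-dec ¬? (Rainbow? f xs)) ⟩
    ∑ᵛ k (λ xs → 𝟙 (does (IsHom? G xs) ∧ does (¬? (Rainbow? f xs))))   ≤⟨ ∑ᵛ-mono-≤ k (λ xs → 𝟙-∧ (does (IsHom? G xs)) _) ⟩
    ∑ᵛ k (λ xs → 𝟙 (does (IsHom? G xs)))                               ≡⟨ count-allVec {k = k} (IsHom? G) ⟨
    hom k G                                                            ∎
    where open ≤-Reasoning

  module _ (diverse : Diverse G f) where

    colourTrace-1 : ∀ L → colourTrace L 1 ≡ 0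
    colourTrace-1 L = trans (sum-cong-≗ (λ c → markedTrace-1 G f diverse c (L ∸ 1))) (sum-replicate-zero m)

    colourTrace-2 : ∀ r → (∀ v → ∣ f v ∣ ≡ r) → ∀ {L} → 2 < L → colourTrace L 2 ≤ r * Δ G * hom (L ∸ 2) G
    colourTrace-2 r ∣f∣≡r {L} 2<L = begin
      colourTrace L 2                 ≤⟨ ∑-markedTrace-2 G f diverse r ∣f∣≡r (L ∸ 2) ⟩
      r * Δ G * tr (A ^ᴹ (L ∸ 2))     ≤⟨ *-monoʳ-≤ (r * Δ G) (tr-adjacency^≤hom G (m<n⇒0<n∸m 2<L)) ⟩
      r * Δ G * hom (L ∸ 2) G         ∎
      where open ≤-Reasoning

    colourTrace-reflect : ∀ L d → d ≤ L → colourTrace L d ≡ colourTrace L (L ∸ d)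
    colourTrace-reflect L d d≤L = sum-cong-≗ λ c →
      trans (markedTrace-comm A (χ c) d (L ∸ d)) (cong (markedTrace A (χ c) (L ∸ d)) (sym (m∸[m∸n]≡n d≤L)))

    colourTrace-log-convex : ∀ ℓ b c → b ≤ ℓ → c ≤ ℓ →
      colourTrace (2 * ℓ) (b + c) * colourTrace (2 * ℓ) (b + c) ≤ colourTrace (2 * ℓ) (b + b) * colourTrace (2 * ℓ) (c + c)
    colourTrace-log-convex ℓ b c b≤ℓ c≤ℓ = subst₂ _≤_
      (cong (λ x → T (b + c) x * T (b + c) x) (complement c b c≤ℓ b≤ℓ))
      (cong₂ _*_ (cong (T (b + b)) (complement b b b≤ℓ b≤ℓ)) (cong (T (c + c)) (complement c c c≤ℓ c≤ℓ)))
      (∑-square≤*-∑ _ _ _ (λ col → markedTrace-log-convex A (adjacency-symmetric G) (χ col) b (ℓ ∸ b) c (ℓ ∸ c)))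
      where
      T : ℕ → ℕ → ℕ
      T x y = ∑[ col < m ] markedTrace A (χ col) x y
      complement : ∀ x y → x ≤ ℓ → y ≤ ℓ → (ℓ ∸ x) + (ℓ ∸ y) ≡ 2 * ℓ ∸ (y + x)
      complement x y x≤ℓ y≤ℓ = begin
        (ℓ ∸ x) + (ℓ ∸ y)                      ≡⟨ m+n∸n≡m _ (y + x) ⟨
        (ℓ ∸ x) + (ℓ ∸ y) + (y + x) ∸ (y + x)  ≡⟨ cong (_∸ (y + x)) (regroup (ℓ ∸ x) (ℓ ∸ y) y x) ⟩
        ((ℓ ∸ x) + x) + ((ℓ ∸ y) + y + 0) ∸ (y + x) ≡⟨ cong₂ (λ a b → a + (b + 0) ∸ (y + x)) (m∸n+n≡m x≤ℓ) (m∸n+n≡m y≤ℓ) ⟩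
        2 * ℓ ∸ (y + x)                        ∎
        where
        open ≡-Reasoning
        regroup : ∀ a b y x → a + b + (y + x) ≡ (a + x) + ((b + y) + 0)
        regroup = solve-∀

nonRainbowHom≤ : ∀ {n m} (G : Graph n) (r : ℕ) (f : Fin n → Subset m) → (∀ v → ∣ f v ∣ ≡ r) → Diverse G f →
  ∀ ℓ → 2 ≤ ℓ → nonRainbowHom (2 * ℓ) G f ≤ 2 * ℓ * (2 * ℓ * (r * Δ G * hom (2 * ℓ ∸ 2) G))
nonRainbowHom≤ G r f ∣f∣≡r diverse ℓ@(suc (suc k)) 2≤ℓ@(s≤s (s≤s _)) = begin
  nonRainbowHom L G f                                                    ≤⟨ nonRainbowHom≤∑colourTrace G f _ ⟩
  ∑[ i < L ] ∑[ j < L ] (𝟙 (does (i Fin.<? j)) * τ (toℕ j ∸ toℕ i))      ≤⟨ ∑-mono-≤ {L} (λ i → ∑-mono-≤ {L} {g = λ _ → τ 2} (term≤τ2 i)) ⟩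
  ∑[ i < L ] ∑[ j < L ] τ 2                                              ≡⟨ trans (sum-cong-≗ {L} (λ _ → ∑-const L (τ 2))) (∑-const L (L * τ 2)) ⟩
  L * (L * τ 2)                                                          ≤⟨ *-monoʳ-≤ L (*-monoʳ-≤ L (colourTrace-2 G f diverse r ∣f∣≡r {L} (≤-trans (s≤s (s≤s (s≤s z≤n))) (*-monoʳ-≤ 2 2≤ℓ)))) ⟩
  L * (L * (r * Δ G * hom (L ∸ 2) G))                                    ∎
  where
  open ≤-Reasoning
  L = 2 * ℓ
  τ = colourTrace G f L
  term≤τ2 : ∀ i j → 𝟙 (does (i Fin.<? j)) * τ (toℕ j ∸ toℕ i) ≤ τ 2
  term≤τ2 i j = bound (i Fin.<? j)
    where
    bound : (i<?j : Dec (toℕ i < toℕ j)) → 𝟙 (does i<?j) * τ (toℕ j ∸ toℕ i) ≤ τ 2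
    bound (no _) = z≤n
    bound (yes i<j) = ≤-trans (≤-reflexive (*-identityˡ (τ (toℕ j ∸ toℕ i))))
      (symmetric-log-convex-≤-2 (suc k) τ (colourTrace-reflect G f diverse L) (colourTrace-log-convex G f diverse ℓ)
        (colourTrace-1 G f diverse L) (toℕ j ∸ toℕ i) (m<n⇒0<n∸m i<j) (≤-<-trans (m∸n≤m (toℕ j) (toℕ i)) (Fin.toℕ<n j)))

lemma5p2 : ∀ {n m : ℕ} (G : Graph n) (r : ℕ) (f : Fin n → Subset m) →
    (∀ v → ∣ f v ∣ ≡ r) → Diverse G f → (ℓ : ℕ) → 2 ≤ ℓ →
    nonRainbowHom (2 * ℓ) G f ^ 2
      ≤ (16 * ℓ) ^ 2 * (r * ℓ * Δ G * hom (2 * ℓ ∸ 2) G * hom (2 * ℓ) G)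
lemma5p2 G r f ∣f∣≡r diverse ℓ@(suc (suc _)) 2≤ℓ@(s≤s (s≤s _)) = begin
  N * (N * 1)                           ≡⟨ cong (N *_) (*-identityʳ N) ⟩
  N * N                                 ≤⟨ *-mono-≤ (nonRainbowHom≤ G r f ∣f∣≡r diverse ℓ 2≤ℓ) (nonRainbowHom≤hom G f (2 * ℓ)) ⟩
  2 * ℓ * (2 * ℓ * (r * Δ G * H′)) * H  ≤⟨ m≤m*n _ (64 * ℓ) ⟩
  2 * ℓ * (2 * ℓ * (r * Δ G * H′)) * H * (64 * ℓ) ≡⟨ rearrange ℓ r (Δ G) H′ H ⟩
  (16 * ℓ) * ((16 * ℓ) * 1) * (r * ℓ * Δ G * H′ * H) ∎
  where
  open ≤-Reasoning
  N = nonRainbowHom (2 * ℓ) G f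
  H = hom (2 * ℓ) G
  H′ = hom (2 * ℓ ∸ 2) G
  rearrange : ∀ ℓ r d a b → 2 * ℓ * (2 * ℓ * (r * d * a)) * b * (64 * ℓ) ≡ (16 * ℓ) * ((16 * ℓ) * 1) * (r * ℓ * d * a * b)
  rearrange = solve-∀
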